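{- For integers $i\ge0$, $j_1\ge0$, $j_2\ge0$ and real $k_1,k_2$, $$\sum_{r=0}^{i}\binom{i}{r}c_{i-r,j_1,k_1}\,c_{r,j_2,k_2}=\binom{j_1+j_2}{j_1}c_{i,j_1+j_2,k_1+k_2}.$$
   Context: The signed Stirling numbers of the first kind $s_{i,r}$ are defined by $x(x-1)\cdots(x-i+1)=\sum_{r=0}^{i}s_{i,r}x^r$. For integers $i,j\ge0$ and real $k$, $c_{i,j,k}=\sum_{r=j}^{i}\binom{r}{j}(-k)^{r-j}s_{i,r}$ (zero if $j>i$). -}

module Defs where

open import Level using (Level)
open import Data.Nat using (ℕ; zero; suc; _∸_; _≤?_) renaming (_+_ to _+ℕ_)
open import Data.Nat.Combinatorics using (_C_)
open import Data.List using (List; []; _∷_)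
open import Relation.Nullary using (yes; no)
open import Algebra.Bundles using (CommutativeRing)

-- Everything is developed over an arbitrary commutative ring R
-- (the paper's k₁, k₂ are reals; ℝ is one instance).
module WithRing {c ℓ : Level} (R : CommutativeRing c ℓ) where
  open CommutativeRing R

  ι : ℕ → Carrier
  ι zero    = 0#
  ι (suc n) = 1# + ι n

  pow : Carrier → ℕ → Carrier
  pow x zero    = 1#
  pow x (suc n) = x * pow x n

  ∑ : ℕ → (ℕ → Carrier) → Carrier
  ∑ zero    f = 0#
  ∑ (suc n) f = ∑ n f + f n

  -- Polynomials over R as coefficient lists, lowest degree first.
  Poly : Set c
  Poly = List Carrier

  coeff : Poly → ℕ → Carrier
  coeff []      _       = 0#
  coeff (a ∷ p) zero    = a
  coeff (a ∷ p) (suc n) = coeff p n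

  addP : Poly → Poly → Poly
  addP []      q       = q
  addP p       []      = p
  addP (a ∷ p) (b ∷ q) = (a + b) ∷ addP p q

  scaleP : Carrier → Poly → Poly
  scaleP a []      = []
  scaleP a (b ∷ p) = (a * b) ∷ scaleP a p

  mulXMinus : Carrier → Poly → Poly
  mulXMinus a p = addP (0# ∷ p) (scaleP (- a) p)

  falling : ℕ → Poly
  falling zero    = 1# ∷ []
  falling (suc i) = mulXMinus (ι i) (falling i)

  s : ℕ → ℕ → Carrier
  s i r = coeff (falling i) r

  -- c_{i,j,k} = Σ_{r=j}^{i} binom(r,j) (-k)^{r-j} s_{i,r}, zero if j > i
  -- (the sum is written with r = j + t, t = 0 .. i-j)
  cc : ℕ → ℕ → Carrier → Carrier
  cc i j k with j ≤? i
  ... | yes _ = ∑ (suc (i ∸ j)) (λ t → ι ((j +ℕ t) C j) * pow (- k) t * s i (j +ℕ t))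
  ... | no  _ = 0#

-- c_{i,j,k} is the coefficient of x^j in the shifted falling factorial (x - k)_i, so
-- (x - k)_{i+1} = (x - k - i) (x - k)_i becomes c_{i+1,j,k} + (k + i) c_{i,j,k} = c_{i,j-1,k}.
-- Read as the coefficient of x^j₁ y^j₂ of a polynomial P_i(x, y), each side of the identity
-- satisfies P_{i+1} = (x + y - k₁ - k₂ - i) P_i and P_0 = 1: the right side because it expands
-- (x + y - k₁ - k₂)_i by the binomial theorem, the left side by Pascal's rule applied to the
-- binomial convolution (this is Vandermonde's identity for falling factorials). A recurrence of
-- this shape determines the family from its initial values.
module Submission where

open import Defs
open import Level using (Level)
open import Data.Nat using (ℕ; zero; suc; _∸_; _<_; _≤_; _≤?_; s≤s) renaming (_+_ to _+ℕ_)
open import Data.Nat.Combinatorics using (_C_; nCk+nC[k+1]≡[n+1]C[k+1]; k>n⇒nCk≡0; nCn≡1)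
import Data.Nat.Properties as ℕ
open import Data.List using ([]; _∷_)
open import Algebra.Bundles using (CommutativeRing)
open import Relation.Nullary using (yes; no)
import Relation.Binary.PropositionalEquality as ≡

module Stirling {c ℓ : Level} (R : CommutativeRing c ℓ) where
  open CommutativeRing R
  open WithRing R
  open import Algebra.Properties.Ring ring using (-‿distribˡ-*)
  open import Algebra.Properties.Group +-group using (∙-cancelʳ)
  open import Algebra.Properties.CommutativeSemigroup +-commutativeSemigroup
    using (interchange; x∙yz≈xz∙y)
  open import Algebra.Solver.Ring.NaturalCoefficients.Default commutativeSemiring
    using (solve; _:+_; _:*_; _:=_)
  open import Relation.Binary.Reasoning.Setoid setoid

  ι-+ : ∀ m n → ι (m +ℕ n) ≈ ι m + ι n
  ι-+ zero    n = sym (+-identityˡ _)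
  ι-+ (suc m) n = trans (+-cong refl (ι-+ m n)) (sym (+-assoc _ _ _))

  ι-pascal : ∀ n k → ι (suc n C suc k) ≈ ι (n C k) + ι (n C suc k)
  ι-pascal n k =
    trans (reflexive (≡.cong ι (≡.sym (nCk+nC[k+1]≡[n+1]C[k+1] n k)))) (ι-+ (n C k) (n C suc k))

  ι-C-vanish : ∀ {n k} → n < k → ι (n C k) ≈ 0#
  ι-C-vanish n<k = reflexive (≡.cong ι (k>n⇒nCk≡0 n<k))

  neg-scale-cancel : ∀ x a y → x + - a * y + a * y ≈ x
  neg-scale-cancel x a y = begin
    x + - a * y + a * y      ≈⟨ +-assoc x _ _ ⟩
    x + (- a * y + a * y)    ≈⟨ +-cong refl (+-cong (-‿distribˡ-* a y) refl) ⟨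
    x + (- (a * y) + a * y)  ≈⟨ +-cong refl (-‿inverseˡ _) ⟩
    x + 0#                   ≈⟨ +-identityʳ x ⟩
    x                        ∎

  neg-scale₂-cancel : ∀ x a b y → x + - a * y + - b * y + (a + b) * y ≈ x
  neg-scale₂-cancel x a b y = begin
    x + - a * y + - b * y + (a + b) * y      ≈⟨ +-cong refl (trans (distribʳ y a b) (+-comm _ _)) ⟩
    x + - a * y + - b * y + (b * y + a * y)  ≈⟨ +-assoc _ _ _ ⟨
    x + - a * y + - b * y + b * y + a * y    ≈⟨ +-cong (neg-scale-cancel _ b y) refl ⟩
    x + - a * y + a * y                      ≈⟨ neg-scale-cancel x a y ⟩
    x                                        ∎

  ∑-cong : ∀ n {f g : ℕ → Carrier} → (∀ t → t < n → f t ≈ g t) → ∑ n f ≈ ∑ n g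
  ∑-cong zero    f≈g = refl
  ∑-cong (suc n) f≈g = +-cong (∑-cong n (λ t t<n → f≈g t (ℕ.m<n⇒m<1+n t<n))) (f≈g n ℕ.≤-refl)

  ∑-zero : ∀ n {f : ℕ → Carrier} → (∀ t → t < n → f t ≈ 0#) → ∑ n f ≈ 0#
  ∑-zero zero    f≈0 = refl
  ∑-zero (suc n) f≈0 =
    trans (+-cong (∑-zero n (λ t t<n → f≈0 t (ℕ.m<n⇒m<1+n t<n))) (f≈0 n ℕ.≤-refl)) (+-identityʳ 0#)

  ∑-distrib-+ : ∀ n (f g : ℕ → Carrier) → ∑ n (λ t → f t + g t) ≈ ∑ n f + ∑ n g
  ∑-distrib-+ zero    f g = sym (+-identityʳ 0#)
  ∑-distrib-+ (suc n) f g = trans (+-cong (∑-distrib-+ n f g) refl) (interchange _ _ _ _)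

  *-distribˡ-∑ : ∀ n a (f : ℕ → Carrier) → a * ∑ n f ≈ ∑ n (λ t → a * f t)
  *-distribˡ-∑ zero    a f = zeroʳ a
  *-distribˡ-∑ (suc n) a f = trans (distribˡ a _ _) (+-cong (*-distribˡ-∑ n a f) refl)

  ∑-unfoldˡ : ∀ n (f : ℕ → Carrier) → ∑ (suc n) f ≈ f 0 + ∑ n (λ t → f (suc t))
  ∑-unfoldˡ zero    f = +-comm 0# (f 0)
  ∑-unfoldˡ (suc n) f = trans (+-cong (∑-unfoldˡ n f) refl) (+-assoc _ _ _)

  ∑-extend : ∀ d n {f : ℕ → Carrier} → (∀ t → n ≤ t → f t ≈ 0#) → ∑ (d +ℕ n) f ≈ ∑ n f
  ∑-extend zero    n f≈0 = refl
  ∑-extend (suc d) n f≈0 =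
    trans (+-cong (∑-extend d n f≈0) (f≈0 (d +ℕ n) (ℕ.m≤n+m n d))) (+-identityʳ _)

  ∑-binomial-pascal : ∀ n (u : ℕ → ℕ → Carrier) →
    ∑ (suc (suc n)) (λ r → ι (suc n C r) * u (suc n ∸ r) r)
      ≈ ∑ (suc n) (λ r → ι (n C r) * (u (suc n ∸ r) r + u (n ∸ r) (suc r)))
  ∑-binomial-pascal n u = begin
    ∑ (suc (suc n)) (λ r → ι (suc n C r) * u (suc n ∸ r) r)
      ≈⟨ ∑-unfoldˡ (suc n) _ ⟩
    u₀ + ∑ (suc n) (λ r → ι (suc n C suc r) * w r)
      ≈⟨ +-cong refl (∑-cong (suc n) (λ r _ → trans (*-cong (ι-pascal n r) refl) (distribʳ _ _ _))) ⟩
    u₀ + ∑ (suc n) (λ r → ι (n C r) * w r + ι (n C suc r) * w r)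
      ≈⟨ +-cong refl (∑-distrib-+ (suc n) _ _) ⟩
    u₀ + (∑ (suc n) (λ r → ι (n C r) * w r) + (∑ n (λ r → ι (n C suc r) * w r) + ι (n C suc n) * w n))
      ≈⟨ +-cong refl (+-cong refl (trans (+-cong refl top-vanishes) (+-identityʳ _))) ⟩
    u₀ + (∑ (suc n) (λ r → ι (n C r) * w r) + ∑ n (λ r → ι (n C suc r) * w r))
      ≈⟨ x∙yz≈xz∙y _ _ _ ⟩
    u₀ + ∑ n (λ r → ι (n C suc r) * w r) + ∑ (suc n) (λ r → ι (n C r) * w r)
      ≈⟨ +-cong (∑-unfoldˡ n _) refl ⟨
    ∑ (suc n) (λ r → ι (n C r) * u (suc n ∸ r) r) + ∑ (suc n) (λ r → ι (n C r) * w r)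
      ≈⟨ ∑-distrib-+ (suc n) _ _ ⟨
    ∑ (suc n) (λ r → ι (n C r) * u (suc n ∸ r) r + ι (n C r) * w r)
      ≈⟨ ∑-cong (suc n) (λ r _ → distribˡ _ _ _) ⟨
    ∑ (suc n) (λ r → ι (n C r) * (u (suc n ∸ r) r + w r)) ∎
    where
    u₀ : Carrier
    u₀ = ι (suc n C 0) * u (suc n) 0
    w : ℕ → Carrier
    w r = u (n ∸ r) (suc r)
    top-vanishes : ι (n C suc n) * w n ≈ 0#
    top-vanishes = trans (*-cong (ι-C-vanish (ℕ.n<1+n n)) refl) (zeroˡ _)

  -- Multiplication by x on coefficient sequences.
  shift : (ℕ → Carrier) → ℕ → Carrier
  shift f zero    = 0#
  shift f (suc j) = f j

  shift-cong : ∀ {f g : ℕ → Carrier} → (∀ j → f j ≈ g j) → ∀ j → shift f j ≈ shift g j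
  shift-cong f≈g zero    = refl
  shift-cong f≈g (suc j) = f≈g j

  VanishesFrom : ℕ → (ℕ → Carrier) → Set ℓ
  VanishesFrom n f = ∀ r → n ≤ r → f r ≈ 0#

  -- If f lists the coefficients of p(x), the coefficient of x^j in p(x + m) is
  -- Σ_t C(j+t, j) m^t f(j+t); taylorShift N keeps the terms t < N.
  taylorShift : ℕ → Carrier → (ℕ → Carrier) → ℕ → Carrier
  taylorShift N m f j = ∑ N (λ t → ι ((j +ℕ t) C j) * pow m t * f (j +ℕ t))

  taylorShift-cong : ∀ N m {f g : ℕ → Carrier} → (∀ r → f r ≈ g r) →
                     ∀ j → taylorShift N m f j ≈ taylorShift N m g j
  taylorShift-cong N m f≈g j = ∑-cong N (λ t _ → *-cong refl (f≈g (j +ℕ t)))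

  taylorShift-+ : ∀ N m (f g : ℕ → Carrier) j →
    taylorShift N m (λ r → f r + g r) j ≈ taylorShift N m f j + taylorShift N m g j
  taylorShift-+ N m f g j = trans (∑-cong N (λ t _ → distribˡ _ _ _)) (∑-distrib-+ N _ _)

  taylorShift-*ˡ : ∀ N m a (f : ℕ → Carrier) j →
    taylorShift N m (λ r → a * f r) j ≈ a * taylorShift N m f j
  taylorShift-*ˡ N m a f j =
    trans (∑-cong N (λ t _ → swap-scalar _ a _)) (sym (*-distribˡ-∑ N a _))
    where
    swap-scalar : ∀ b a x → b * (a * x) ≈ a * (b * x)
    swap-scalar = solve 3 (λ b a x → b :* (a :* x) := a :* (b :* x)) refl

  taylorShift-vanish : ∀ N m {n f} j → VanishesFrom n f → n ≤ j → taylorShift N m f j ≈ 0#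
  taylorShift-vanish N m j f≈0 n≤j =
    ∑-zero N (λ t _ → trans (*-cong refl (f≈0 _ (ℕ.≤-trans n≤j (ℕ.m≤m+n j t)))) (zeroʳ _))

  taylorShift-extend : ∀ d N m {n f} j → VanishesFrom n f → n ≤ j +ℕ N →
                       taylorShift (d +ℕ N) m f j ≈ taylorShift N m f j
  taylorShift-extend d N m j f≈0 n≤j+N =
    ∑-extend d N (λ t N≤t → trans (*-cong refl (f≈0 _ (ℕ.≤-trans n≤j+N (ℕ.+-monoʳ-≤ j N≤t)))) (zeroʳ _))

  pull-scalar : ∀ a m p q → a * (m * p) * q ≈ m * (a * p * q)
  pull-scalar = solve 4 (λ a m p q → a :* (m :* p) :* q := m :* (a :* p :* q)) refl

  -- Both sides are the coefficients of (x + m) p(x + m).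
  taylorShift-shift : ∀ N m f j →
    taylorShift (suc N) m (shift f) j ≈ shift (taylorShift (suc N) m f) j + m * taylorShift N m f j
  taylorShift-shift N m f zero =
    trans (∑-unfoldˡ N _)
      (+-cong (zeroʳ _) (trans (∑-cong N (λ t _ → pull-scalar _ m _ _)) (sym (*-distribˡ-∑ N m _))))
  taylorShift-shift N m f (suc j) = begin
    taylorShift (suc N) m (shift f) (suc j)
      ≈⟨ ∑-cong (suc N) (λ t _ → trans (*-cong (*-cong (ι-pascal (j +ℕ t) j) refl) refl)
                                        (trans (*-cong (distribʳ _ _ _) refl) (distribʳ _ _ _))) ⟩
    ∑ (suc N) (λ t → ι ((j +ℕ t) C j) * pow m t * f (j +ℕ t) + upper t)
      ≈⟨ ∑-distrib-+ (suc N) _ upper ⟩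
    taylorShift (suc N) m f j + ∑ (suc N) upper
      ≈⟨ +-cong refl (∑-unfoldˡ N upper) ⟩
    taylorShift (suc N) m f j + (upper 0 + ∑ N (λ t → upper (suc t)))
      ≈⟨ +-cong refl (trans (+-cong upper-0 refl) (+-identityˡ _)) ⟩
    taylorShift (suc N) m f j + ∑ N (λ t → upper (suc t))
      ≈⟨ +-cong refl (trans (∑-cong N (λ t _ → upper-suc t)) (sym (*-distribˡ-∑ N m _))) ⟩
    taylorShift (suc N) m f j + m * taylorShift N m f (suc j) ∎
    where
    upper : ℕ → Carrier
    upper t = ι ((j +ℕ t) C suc j) * pow m t * f (j +ℕ t)
    upper-0 : upper 0 ≈ 0#
    upper-0 = trans (*-cong (*-cong (ι-C-vanish (s≤s (ℕ.≤-reflexive (ℕ.+-identityʳ j)))) refl) refl)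
                    (trans (*-cong (zeroˡ _) refl) (zeroˡ _))
    upper-suc : ∀ t → upper (suc t) ≈ m * (ι ((suc j +ℕ t) C suc j) * pow m t * f (suc j +ℕ t))
    upper-suc t =
      trans (reflexive (≡.cong (λ n → ι (n C suc j) * (m * pow m t) * f n) (ℕ.+-suc j t)))
            (pull-scalar _ m _ _)

  coeff-addP : ∀ p q n → coeff (addP p q) n ≈ coeff p n + coeff q n
  coeff-addP []      q       n       = sym (+-identityˡ _)
  coeff-addP (a ∷ p) []      n       = sym (+-identityʳ _)
  coeff-addP (a ∷ p) (b ∷ q) zero    = refl
  coeff-addP (a ∷ p) (b ∷ q) (suc n) = coeff-addP p q n

  coeff-scaleP : ∀ a p n → coeff (scaleP a p) n ≈ a * coeff p n
  coeff-scaleP a []      n       = sym (zeroʳ a)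
  coeff-scaleP a (b ∷ p) zero    = refl
  coeff-scaleP a (b ∷ p) (suc n) = coeff-scaleP a p n

  coeff-0∷ : ∀ p n → coeff (0# ∷ p) n ≈ shift (coeff p) n
  coeff-0∷ p zero    = refl
  coeff-0∷ p (suc n) = refl

  s-suc : ∀ i r → s (suc i) r ≈ shift (s i) r + - ι i * s i r
  s-suc i r = trans (coeff-addP (0# ∷ falling i) (scaleP (- ι i) (falling i)) r)
                    (+-cong (coeff-0∷ (falling i) r) (coeff-scaleP (- ι i) (falling i) r))

  s-vanish : ∀ i → VanishesFrom (suc i) (s i)
  s-vanish zero    (suc r) _ = refl
  s-vanish (suc i) (suc r) (s≤s i<r) = begin
    s (suc i) (suc r)                          ≈⟨ s-suc i (suc r) ⟩
    s i r + - ι i * s i (suc r)                ≈⟨ +-cong (s-vanish i r i<r)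
                                                   (*-cong refl (s-vanish i (suc r) (ℕ.m≤n⇒m≤1+n i<r))) ⟩
    0# + - ι i * 0#                            ≈⟨ trans (+-identityˡ _) (zeroʳ _) ⟩
    0#                                         ∎

  cc≈taylorShift : ∀ d i j k → cc i j k ≈ taylorShift (d +ℕ suc i) (- k) (s i) j
  cc≈taylorShift d i j k with j ≤? i
  ... | yes j≤i = begin
    taylorShift (suc (i ∸ j)) (- k) (s i) j
      ≈⟨ taylorShift-extend (d +ℕ j) _ (- k) j (s-vanish i) (ℕ.≤-reflexive (≡.sym top)) ⟨
    taylorShift ((d +ℕ j) +ℕ suc (i ∸ j)) (- k) (s i) j
      ≡⟨ ≡.cong (λ N → taylorShift N (- k) (s i) j) (≡.trans (ℕ.+-assoc d j _) (≡.cong (d +ℕ_) top)) ⟩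
    taylorShift (d +ℕ suc i) (- k) (s i) j ∎
    where
    top : j +ℕ suc (i ∸ j) ≡.≡ suc i
    top = ≡.trans (ℕ.+-suc j (i ∸ j)) (≡.cong suc (ℕ.m+[n∸m]≡n j≤i))
  ... | no j≰i = sym (taylorShift-vanish (d +ℕ suc i) (- k) j (s-vanish i) (ℕ.≰⇒> j≰i))

  cc-suc : ∀ i j k → cc (suc i) j k + (k + ι i) * cc i j k ≈ shift (λ j′ → cc i j′ k) j
  cc-suc i j k = begin
    cc (suc i) j k + (k + ι i) * cc i j k
      ≈⟨ +-cong (cc≈taylorShift 0 (suc i) j k) refl ⟩
    T (suc (suc i)) (s (suc i)) j + (k + ι i) * cc i j k
      ≈⟨ +-cong expand refl ⟩
    shift (λ j′ → cc i j′ k) j + - k * cc i j k + - ι i * cc i j k + (k + ι i) * cc i j k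
      ≈⟨ neg-scale₂-cancel _ k (ι i) _ ⟩
    shift (λ j′ → cc i j′ k) j ∎
    where
    T : ℕ → (ℕ → Carrier) → ℕ → Carrier
    T N = taylorShift N (- k)
    expand : T (suc (suc i)) (s (suc i)) j
               ≈ shift (λ j′ → cc i j′ k) j + - k * cc i j k + - ι i * cc i j k
    expand = begin
      T (suc (suc i)) (s (suc i)) j
        ≈⟨ taylorShift-cong (suc (suc i)) (- k) (s-suc i) j ⟩
      T (suc (suc i)) (λ r → shift (s i) r + - ι i * s i r) j
        ≈⟨ taylorShift-+ (suc (suc i)) (- k) (shift (s i)) (λ r → - ι i * s i r) j ⟩
      T (suc (suc i)) (shift (s i)) j + T (suc (suc i)) (λ r → - ι i * s i r) j
        ≈⟨ +-cong (taylorShift-shift (suc i) (- k) (s i) j) (taylorShift-*ˡ (suc (suc i)) (- k) (- ι i) (s i) j) ⟩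
      shift (T (suc (suc i)) (s i)) j + - k * T (suc i) (s i) j + - ι i * T (suc (suc i)) (s i) j
        ≈⟨ +-cong (+-cong (shift-cong (λ j′ → sym (cc≈taylorShift 1 i j′ k)) j)
                          (*-cong refl (sym (cc≈taylorShift 0 i j k))))
                  (*-cong refl (sym (cc≈taylorShift 1 i j k))) ⟩
      shift (λ j′ → cc i j′ k) j + - k * cc i j k + - ι i * cc i j k ∎

  cc-0-0 : ∀ k → cc 0 0 k ≈ 1#
  cc-0-0 k = trans (cc≈taylorShift 0 0 0 k)
                   (trans (+-identityˡ _) (trans (*-identityʳ _) (trans (*-identityʳ _) (+-identityʳ 1#))))

  cc-0-suc : ∀ j k → cc 0 (suc j) k ≈ 0#
  cc-0-suc j k = trans (cc≈taylorShift 0 0 (suc j) k) (trans (+-identityˡ _) (zeroʳ _))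

  Family : Set c
  Family = ℕ → ℕ → ℕ → Carrier

  -- X i j₁ j₂ as the coefficient of x^j₁ y^j₂ in P_i: P_{i+1} = (x + y - K - i) P_i.
  Recurrent : Carrier → Family → Set ℓ
  Recurrent K X = ∀ i j₁ j₂ →
    X (suc i) j₁ j₂ + (K + ι i) * X i j₁ j₂ ≈ shift (λ a → X i a j₂) j₁ + shift (λ b → X i j₁ b) j₂

  recurrent-unique : ∀ {K X Y} → Recurrent K X → Recurrent K Y →
                     (∀ j₁ j₂ → X 0 j₁ j₂ ≈ Y 0 j₁ j₂) → ∀ i j₁ j₂ → X i j₁ j₂ ≈ Y i j₁ j₂
  recurrent-unique recX recY X₀≈Y₀ zero = X₀≈Y₀
  recurrent-unique {K} {X} {Y} recX recY X₀≈Y₀ (suc i) j₁ j₂ = ∙-cancelʳ _ _ _ (begin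
    X (suc i) j₁ j₂ + (K + ι i) * X i j₁ j₂
      ≈⟨ recX i j₁ j₂ ⟩
    shift (λ a → X i a j₂) j₁ + shift (λ b → X i j₁ b) j₂
      ≈⟨ +-cong (shift-cong (λ a → Xᵢ≈Yᵢ a j₂) j₁) (shift-cong (Xᵢ≈Yᵢ j₁) j₂) ⟩
    shift (λ a → Y i a j₂) j₁ + shift (λ b → Y i j₁ b) j₂
      ≈⟨ recY i j₁ j₂ ⟨
    Y (suc i) j₁ j₂ + (K + ι i) * Y i j₁ j₂
      ≈⟨ +-cong refl (*-cong refl (Xᵢ≈Yᵢ j₁ j₂)) ⟨
    Y (suc i) j₁ j₂ + (K + ι i) * X i j₁ j₂ ∎)
    where
    Xᵢ≈Yᵢ : ∀ j₁ j₂ → X i j₁ j₂ ≈ Y i j₁ j₂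
    Xᵢ≈Yᵢ = recurrent-unique recX recY X₀≈Y₀ i

  -- (x + y) q(x + y) = x q(x + y) + y q(x + y), compared on the coefficient of x^j₁ y^j₂.
  shift-binomial : ∀ (f : ℕ → Carrier) j₁ j₂ →
    ι ((j₁ +ℕ j₂) C j₁) * shift f (j₁ +ℕ j₂)
      ≈ shift (λ a → ι ((a +ℕ j₂) C a) * f (a +ℕ j₂)) j₁ + shift (λ b → ι ((j₁ +ℕ b) C j₁) * f (j₁ +ℕ b)) j₂
  shift-binomial f zero    zero    = trans (zeroʳ _) (sym (+-identityʳ 0#))
  shift-binomial f zero    (suc b) = sym (+-identityˡ _)
  shift-binomial f (suc a) zero rewrite ℕ.+-identityʳ a =
    trans (*-cong (reflexive (≡.cong ι (≡.trans (nCn≡1 (suc a)) (≡.sym (nCn≡1 a))))) refl)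
          (sym (+-identityʳ _))
  shift-binomial f (suc a) (suc b) = begin
    ι (suc n C suc a) * f n                              ≈⟨ *-cong (ι-pascal n a) refl ⟩
    (ι (n C a) + ι (n C suc a)) * f n                    ≈⟨ distribʳ _ _ _ ⟩
    ι (n C a) * f n + ι (n C suc a) * f n                ≡⟨ ≡.cong (λ m → ι (n C a) * f n + ι (m C suc a) * f m) (ℕ.+-suc a b) ⟩
    ι (n C a) * f n + ι (suc (a +ℕ b) C suc a) * f (suc (a +ℕ b)) ∎
    where
    n : ℕ
    n = a +ℕ suc b

  stirlingBinomial : Carrier → Family
  stirlingBinomial K i j₁ j₂ = ι ((j₁ +ℕ j₂) C j₁) * cc i (j₁ +ℕ j₂) K

  stirlingBinomial-recurrent : ∀ K → Recurrent K (stirlingBinomial K)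
  stirlingBinomial-recurrent K i j₁ j₂ = begin
    b * cc (suc i) n K + (K + ι i) * (b * cc i n K)  ≈⟨ factor b _ _ _ ⟩
    b * (cc (suc i) n K + (K + ι i) * cc i n K)      ≈⟨ *-cong refl (cc-suc i n K) ⟩
    b * shift (λ j → cc i j K) n                     ≈⟨ shift-binomial (λ j → cc i j K) j₁ j₂ ⟩
    _                                                ∎
    where
    n : ℕ
    n = j₁ +ℕ j₂
    b : Carrier
    b = ι (n C j₁)
    factor : ∀ b x a y → b * x + a * (b * y) ≈ b * (x + a * y)
    factor = solve 4 (λ b x a y → b :* x :+ a :* (b :* y) := b :* (x :+ a :* y)) refl

  stirlingConvolution : Carrier → Carrier → Family
  stirlingConvolution k₁ k₂ i j₁ j₂ = ∑ (suc i) (λ r → ι (i C r) * cc (i ∸ r) j₁ k₁ * cc r j₂ k₂)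

  stirlingConvolution-recurrent : ∀ k₁ k₂ → Recurrent (k₁ + k₂) (stirlingConvolution k₁ k₂)
  stirlingConvolution-recurrent k₁ k₂ i j₁ j₂ = begin
    F (suc i) j₁ j₂ + (K + ι i) * F i j₁ j₂
      ≈⟨ +-cong (trans (∑-cong (suc (suc i)) (λ r _ → *-assoc _ _ _))
                       (∑-binomial-pascal i (λ p q → α p j₁ * β q j₂)))
                (*-distribˡ-∑ (suc i) _ _) ⟩
    ∑ (suc i) (λ r → ι (i C r) * (α (suc i ∸ r) j₁ * β r j₂ + α (i ∸ r) j₁ * β (suc r) j₂))
      + ∑ (suc i) (λ r → (K + ι i) * (ι (i C r) * α (i ∸ r) j₁ * β r j₂))
      ≈⟨ ∑-distrib-+ (suc i) _ _ ⟨
    ∑ (suc i) (λ r → ι (i C r) * (α (suc i ∸ r) j₁ * β r j₂ + α (i ∸ r) j₁ * β (suc r) j₂)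
                      + (K + ι i) * (ι (i C r) * α (i ∸ r) j₁ * β r j₂))
      ≈⟨ ∑-cong (suc i) termwise ⟩
    ∑ (suc i) (λ r → ι (i C r) * shift (α (i ∸ r)) j₁ * β r j₂ + ι (i C r) * α (i ∸ r) j₁ * shift (β r) j₂)
      ≈⟨ ∑-distrib-+ (suc i) _ _ ⟩
    _ + _
      ≈⟨ +-cong (shift-first j₁) (shift-second j₂) ⟨
    shift (λ a → F i a j₂) j₁ + shift (λ b → F i j₁ b) j₂ ∎
    where
    K : Carrier
    K = k₁ + k₂
    F : Family
    F = stirlingConvolution k₁ k₂
    α β : ℕ → ℕ → Carrier
    α n j = cc n j k₁
    β n j = cc n j k₂

    regroup : ∀ c A′ A B B′ k₁ k₂ x y →
      c * (A′ * B + A * B′) + ((k₁ + k₂) + (x + y)) * (c * A * B)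
        ≈ c * (A′ + (k₁ + x) * A) * B + c * A * (B′ + (k₂ + y) * B)
    regroup = solve 9 (λ c A′ A B B′ k₁ k₂ x y →
      c :* (A′ :* B :+ A :* B′) :+ ((k₁ :+ k₂) :+ (x :+ y)) :* (c :* A :* B)
        := c :* (A′ :+ (k₁ :+ x) :* A) :* B :+ c :* A :* (B′ :+ (k₂ :+ y) :* B)) refl

    termwise : ∀ r → r < suc i →
      ι (i C r) * (α (suc i ∸ r) j₁ * β r j₂ + α (i ∸ r) j₁ * β (suc r) j₂)
        + (K + ι i) * (ι (i C r) * α (i ∸ r) j₁ * β r j₂)
        ≈ ι (i C r) * shift (α (i ∸ r)) j₁ * β r j₂ + ι (i C r) * α (i ∸ r) j₁ * shift (β r) j₂
    termwise r (s≤s r≤i) = begin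
      _ ≡⟨ ≡.cong (λ p → ι (i C r) * (α p j₁ * β r j₂ + α (i ∸ r) j₁ * β (suc r) j₂)
                          + (K + ι i) * (ι (i C r) * α (i ∸ r) j₁ * β r j₂))
                  (ℕ.+-∸-assoc 1 r≤i) ⟩
      _ ≈⟨ +-cong refl (*-cong (+-cong refl split-i) refl) ⟨
      _ ≈⟨ regroup _ _ _ _ _ k₁ k₂ _ _ ⟩
      _ ≈⟨ +-cong (*-cong (*-cong refl (cc-suc (i ∸ r) j₁ k₁)) refl)
                  (*-cong refl (cc-suc r j₂ k₂)) ⟩
      _ ∎
      where
      split-i : ι (i ∸ r) + ι r ≈ ι i
      split-i = trans (sym (ι-+ (i ∸ r) r)) (reflexive (≡.cong ι (ℕ.m∸n+n≡m r≤i)))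

    shift-first : ∀ j → shift (λ a → F i a j₂) j
                          ≈ ∑ (suc i) (λ r → ι (i C r) * shift (α (i ∸ r)) j * β r j₂)
    shift-first zero    = sym (∑-zero (suc i) (λ r _ → trans (*-cong (zeroʳ _) refl) (zeroˡ _)))
    shift-first (suc j) = refl

    shift-second : ∀ j → shift (λ b → F i j₁ b) j
                           ≈ ∑ (suc i) (λ r → ι (i C r) * α (i ∸ r) j₁ * shift (β r) j)
    shift-second zero    = sym (∑-zero (suc i) (λ r _ → zeroʳ _))
    shift-second (suc j) = refl

  initial-agree : ∀ k₁ k₂ j₁ j₂ →
    stirlingConvolution k₁ k₂ 0 j₁ j₂ ≈ stirlingBinomial (k₁ + k₂) 0 j₁ j₂
  initial-agree k₁ k₂ zero zero =
    trans (+-identityˡ _)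
      (trans (*-cong (trans (*-cong refl (cc-0-0 k₁)) (*-identityʳ _)) (cc-0-0 k₂))
        (*-cong refl (sym (cc-0-0 (k₁ + k₂)))))
  initial-agree k₁ k₂ zero (suc j₂) =
    trans (trans (+-identityˡ _) (trans (*-cong refl (cc-0-suc j₂ k₂)) (zeroʳ _)))
      (sym (trans (*-cong refl (cc-0-suc j₂ (k₁ + k₂))) (zeroʳ _)))
  initial-agree k₁ k₂ (suc j₁) j₂ =
    trans (trans (+-identityˡ _) (trans (*-cong (trans (*-cong refl (cc-0-suc j₁ k₁)) (zeroʳ _)) refl) (zeroˡ _)))
      (sym (trans (*-cong refl (cc-0-suc (j₁ +ℕ j₂) (k₁ + k₂))) (zeroʳ _)))

theorem2p11 : ∀ {c ℓ : Level} (R : CommutativeRing c ℓ) →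
    let open CommutativeRing R in
    let open WithRing R in
    (i j₁ j₂ : ℕ) (k₁ k₂ : Carrier) →
    ∑ (suc i) (λ r → ι (i C r) * cc (i ∸ r) j₁ k₁ * cc r j₂ k₂)
      ≈ ι ((j₁ +ℕ j₂) C j₁) * cc i (j₁ +ℕ j₂) (k₁ + k₂)
theorem2p11 R i j₁ j₂ k₁ k₂ =
  recurrent-unique (stirlingConvolution-recurrent k₁ k₂) (stirlingBinomial-recurrent (k₁ + k₂))
                   (initial-agree k₁ k₂) i j₁ j₂
  where
  open CommutativeRing R using (_+_)
  open Stirling R
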